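{- Let $m$ and $n$ be powers of $2$ with $m \geq 16$, $n \geq 4$ and $m \leq 4n$, let $$G = \langle a, b \mid a^m = 1,\ b^n = 1,\ [b,a] = a^4 \rangle ,$$ and let $N = \langle a^4 \rangle$. Then $N$ is a characteristic subgroup of $G$ and $G/N$ is abelian, but no automorphism of $G$ induces on $G/N$ the inverting automorphism $gN \mapsto g^{ -1}N$.
   Context: The commutator convention is $[x,y] = x^{ -1}y^{ -1}xy$. -}

module Defs where

open import Data.Nat using (ℕ; zero; suc; _*_; _^_)
open import Relation.Binary.PropositionalEquality using (_≡_)
open import Data.Integer using (ℤ; +_; -[1+_])
open import Data.Bool using (Bool; true; false; not)
open import Data.List using (List; []; _∷_; _++_; reverse; map; replicate; concat)
open import Data.Product using (_×_; _,_; ∃; Σ)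
open import Relation.Nullary using (¬_)

data Gen : Set where
  ga gb : Gen

-- A letter is a generator with an exponent sign (true = +1, false = -1)
Letter : Set
Letter = Gen × Bool

Word : Set
Word = List Letter

invL : Letter → Letter
invL (g , s) = (g , not s)

invW : Word → Word
invW w = reverse (map invL w)

a a⁻ b b⁻ : Word
a  = (ga , true)  ∷ []
a⁻ = (ga , false) ∷ []
b  = (gb , true)  ∷ []
b⁻ = (gb , false) ∷ []

npow : Word → ℕ → Word
npow w k = concat (replicate k w)

zpow : Word → ℤ → Word
zpow w (+ k)     = npow w k
zpow w -[1+ k ]  = npow (invW w) (suc k)

comm : Word → Word → Word
comm x y = invW x ++ invW y ++ x ++ y

data Relator (m n : ℕ) : Word → Set where
  rel-a  : Relator m n (npow a m)
  rel-b  : Relator m n (npow b n)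
  rel-ba : Relator m n (comm b a ++ npow a⁻ 4)

-- Equality in the presented group G: the smallest equivalence relation on
-- words containing free cancellation and deletion of relators in any context.
-- (Word / ≈ is exactly the quotient of the free group by the normal closure
-- of the relators.)
data _≈⟨_,_⟩_ : Word → ℕ → ℕ → Word → Set where
  ≈-refl   : ∀ {m n w} → w ≈⟨ m , n ⟩ w
  ≈-sym    : ∀ {m n u v} → u ≈⟨ m , n ⟩ v → v ≈⟨ m , n ⟩ u
  ≈-trans  : ∀ {m n u v w} → u ≈⟨ m , n ⟩ v → v ≈⟨ m , n ⟩ w → u ≈⟨ m , n ⟩ w
  ≈-cancel : ∀ {m n} u v x → (u ++ x ∷ invL x ∷ v) ≈⟨ m , n ⟩ (u ++ v)
  ≈-rel    : ∀ {m n} u v r → Relator m n r → (u ++ r ++ v) ≈⟨ m , n ⟩ (u ++ v)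

record Aut (m n : ℕ) : Set where
  field
    f      : Word → Word
    resp   : ∀ {x y} → x ≈⟨ m , n ⟩ y → f x ≈⟨ m , n ⟩ f y
    hom    : ∀ x y → f (x ++ y) ≈⟨ m , n ⟩ (f x ++ f y)
    inj    : ∀ {x y} → f x ≈⟨ m , n ⟩ f y → x ≈⟨ m , n ⟩ y
    surj   : ∀ y → Σ Word (λ x → f x ≈⟨ m , n ⟩ y)

InN : (m n : ℕ) → Word → Set
InN m n w = ∃ λ (k : ℤ) → w ≈⟨ m , n ⟩ zpow (npow a 4) k

Characteristic : (m n : ℕ) → Set
Characteristic m n = ∀ (φ : Aut m n) → ∀ w →
  (InN m n w → InN m n (Aut.f φ w)) × (InN m n (Aut.f φ w) → InN m n w)

-- G/N is abelian: xyN = yxN for all x, y, i.e. (yx)⁻¹(xy) ∈ N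
QuotientAbelian : (m n : ℕ) → Set
QuotientAbelian m n = ∀ x y → InN m n (invW (y ++ x) ++ (x ++ y))

-- φ induces inversion on G/N: φ(g)N = g⁻¹N for all g, i.e. (g⁻¹)⁻¹ φ(g) = g φ(g) ∈ N
InducesInversion : (m n : ℕ) → Aut m n → Set
InducesInversion m n φ = ∀ g → InN m n (g ++ Aut.f φ g)

IsPow2 : ℕ → Set
IsPow2 m = ∃ λ k → m ≡ 2 ^ k

{-# OPTIONS --safe #-}
module Submission where

-- Write m = 4 + 4v, n = 1 + n′ and t = 1 + 4v, so that t ≡ -3 (mod m). As m and n are powers of 2
-- with m ≤ 4n, t ^ n ≡ 1 (mod m), so b acting on ℤ/m by multiplication with t defines the
-- semidirect product ℤ/n ⋉ ℤ/m; the relations reduce every word to a normal form b ^ j a ^ i, and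
-- evaluating words in ℤ/n ⋉ ℤ/m shows that G is this semidirect product.
-- Then b ^ j a ^ i ↦ (j mod n , i mod 4) is a homomorphism onto an abelian group with kernel
-- N = ⟨a⁴⟩. Since a⁴ = [b,a], N is the derived subgroup: it is characteristic and G/N is abelian.
-- An automorphism inducing inversion on G/N sends a to a ^ i with i ≡ -1 (mod 4) and b to b⁻¹ a ^ j.
-- Applied to a b = b a ^ t this gives i t⁻¹ ≡ t i, so 8 i ≡ (t² - 1) i ≡ 0 (mod m), which is
-- impossible for odd i as 16 ∣ m.

open import Defs
open import Data.Nat using (ℕ; zero; suc; _+_; _*_; _∸_; _^_; _%_; _/_; _≤_; _<_; z≤n; s≤s; NonZero)
open import Data.Nat.Properties
open import Data.Nat.DivMod
open import Data.Nat.Divisibility using (_∣_; divides; ∣-trans; ∣m⇒∣m*n; m%n≡0⇒n∣m)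
open import Data.Nat.Tactic.RingSolver using (solve-∀)
open import Algebra.Properties.CommutativeSemigroup *-commutativeSemigroup using (x∙yz≈y∙xz)
open import Data.Bool using (true; false)
open import Data.Bool.Properties using (not-involutive)
open import Data.Integer using (+_; -[1+_])
open import Data.List using ([]; _∷_; _++_; reverse; map)
open import Data.List.Properties using (++-assoc; ++-identityʳ; reverse-++; map-++; unfold-reverse)
open import Data.Product using (_×_; Σ; _,_; proj₁; proj₂; ∃)
open import Level using (0ℓ)
open import Relation.Nullary using (¬_)
open import Relation.Binary.Bundles using (Setoid)
open import Relation.Binary.PropositionalEquality hiding (resp)
import Relation.Binary.Reasoning.Setoid as SetoidReasoning

infix 4 _≡_[mod_]
record _≡_[mod_] (x y d : ℕ) .{{_ : NonZero d}} : Set where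
  constructor from-%
  field to-% : x % d ≡ y % d
open _≡_[mod_]

module _ {d : ℕ} .{{_ : NonZero d}} where

  mod-reflexive : ∀ {x y} → x ≡ y → x ≡ y [mod d ]
  mod-reflexive x≡y = from-% (cong (_% d) x≡y)

  mod-refl : ∀ {x} → x ≡ x [mod d ]
  mod-refl = from-% refl

  mod-sym : ∀ {x y} → x ≡ y [mod d ] → y ≡ x [mod d ]
  mod-sym (from-% e) = from-% (sym e)

  mod-trans : ∀ {x y z} → x ≡ y [mod d ] → y ≡ z [mod d ] → x ≡ z [mod d ]
  mod-trans (from-% e) (from-% f) = from-% (trans e f)

  mod-setoid : Setoid 0ℓ 0ℓ
  mod-setoid = record
    { Carrier = ℕ
    ; _≈_ = _≡_[mod d ]
    ; isEquivalence = record { refl = mod-refl ; sym = mod-sym ; trans = mod-trans }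
    }

  %-mod : ∀ x → x % d ≡ x [mod d ]
  %-mod x = from-% (m%n%n≡m%n x d)

  d≡0-mod : d ≡ 0 [mod d ]
  d≡0-mod = from-% (trans (n%n≡0 d) (sym (m*n%n≡0 0 d)))

  +-*-mod : ∀ x k → x + k * d ≡ x [mod d ]
  +-*-mod x k = from-% ([m+kn]%n≡m%n x k d)

  +-cong-mod : ∀ {x x′ y y′} → x ≡ x′ [mod d ] → y ≡ y′ [mod d ] → x + y ≡ x′ + y′ [mod d ]
  +-cong-mod {x} {x′} {y} {y′} (from-% x≡x′) (from-% y≡y′) = from-% (begin
    (x + y) % d            ≡⟨ %-distribˡ-+ x y d ⟩
    (x % d + y % d) % d    ≡⟨ cong₂ (λ p q → (p + q) % d) x≡x′ y≡y′ ⟩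
    (x′ % d + y′ % d) % d  ≡⟨ %-distribˡ-+ x′ y′ d ⟨
    (x′ + y′) % d          ∎)
    where open ≡-Reasoning

  *-cong-mod : ∀ {x x′ y y′} → x ≡ x′ [mod d ] → y ≡ y′ [mod d ] → x * y ≡ x′ * y′ [mod d ]
  *-cong-mod {x} {x′} {y} {y′} (from-% x≡x′) (from-% y≡y′) = from-% (begin
    (x * y) % d            ≡⟨ %-distribˡ-* x y d ⟩
    (x % d * (y % d)) % d  ≡⟨ cong₂ (λ p q → (p * q) % d) x≡x′ y≡y′ ⟩
    (x′ % d * (y′ % d)) % d ≡⟨ %-distribˡ-* x′ y′ d ⟨
    (x′ * y′) % d          ∎)
    where open ≡-Reasoning

  +-inverse-mod : ∀ x → (d ∸ x % d) + x ≡ 0 [mod d ]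
  +-inverse-mod x = mod-trans (+-cong-mod (mod-refl {d ∸ x % d}) (mod-sym (%-mod x)))
    (mod-trans (mod-reflexive (m∸n+n≡m (<⇒≤ (m%n<n x d)))) d≡0-mod)

  +-cancelˡ-mod : ∀ x {y z} → x + y ≡ x + z [mod d ] → y ≡ z [mod d ]
  +-cancelˡ-mod x {y} {z} x+y≡x+z = begin
    y                ≈⟨ +-cong-mod (+-inverse-mod x) mod-refl ⟨
    (x̄ + x) + y      ≡⟨ +-assoc x̄ x y ⟩
    x̄ + (x + y)      ≈⟨ +-cong-mod (mod-refl {x̄}) x+y≡x+z ⟩
    x̄ + (x + z)      ≡⟨ +-assoc x̄ x z ⟨
    (x̄ + x) + z      ≈⟨ +-cong-mod (+-inverse-mod x) mod-refl ⟩
    z                ∎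
    where
    open SetoidReasoning mod-setoid
    x̄ = d ∸ x % d

  *-≡1-mod : ∀ y {x} → x ≡ 1 [mod d ] → y * x ≡ y [mod d ]
  *-≡1-mod y x≡1 = mod-trans (*-cong-mod (mod-refl {y}) x≡1) (mod-reflexive (*-identityʳ y))

  ^-≡1-mod : ∀ {x} → x ≡ 1 [mod d ] → ∀ q → x ^ q ≡ 1 [mod d ]
  ^-≡1-mod x≡1 zero = mod-refl
  ^-≡1-mod x≡1 (suc q) = *-cong-mod x≡1 (^-≡1-mod x≡1 q)

  ^-reduce-mod : ∀ {x e} .{{_ : NonZero e}} → x ^ e ≡ 1 [mod d ] → ∀ k → x ^ k ≡ x ^ (k % e) [mod d ]
  ^-reduce-mod {x} {e} x^e≡1 k = begin
    x ^ k                          ≡⟨ cong (x ^_) (m≡m%n+[m/n]*n k e) ⟩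
    x ^ (k % e + k / e * e)        ≡⟨ ^-distribˡ-+-* x (k % e) (k / e * e) ⟩
    x ^ (k % e) * x ^ (k / e * e)  ≡⟨ cong (λ z → x ^ (k % e) * x ^ z) (*-comm (k / e) e) ⟩
    x ^ (k % e) * x ^ (e * (k / e)) ≡⟨ cong (x ^ (k % e) *_) (^-*-assoc x e (k / e)) ⟨
    x ^ (k % e) * (x ^ e) ^ (k / e) ≈⟨ *-≡1-mod (x ^ (k % e)) (^-≡1-mod x^e≡1 (k / e)) ⟩
    x ^ (k % e)                    ∎
    where open SetoidReasoning mod-setoid

  ^-congʳ-mod : ∀ {x e k l} .{{_ : NonZero e}} → x ^ e ≡ 1 [mod d ] → k ≡ l [mod e ] →
                x ^ k ≡ x ^ l [mod d ]
  ^-congʳ-mod {x} {k = k} {l} x^e≡1 (from-% k≡l) =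
    mod-trans (^-reduce-mod x^e≡1 k)
      (mod-trans (mod-reflexive (cong (x ^_) k≡l)) (mod-sym (^-reduce-mod x^e≡1 l)))

  mod-∣ : ∀ {d′ x y} .{{_ : NonZero d′}} → d ∣ d′ → x ≡ y [mod d′ ] → x ≡ y [mod d ]
  mod-∣ {d′} {x} {y} d∣d′ (from-% x≡y) = from-% (begin
    x % d        ≡⟨ m∣n⇒o%n%m≡o%m d d′ x d∣d′ ⟨
    x % d′ % d   ≡⟨ cong (_% d) x≡y ⟩
    y % d′ % d   ≡⟨ m∣n⇒o%n%m≡o%m d d′ y d∣d′ ⟩
    y % d        ∎)
    where open ≡-Reasoning

1+x≡0-mod4⇒8x≢0-mod16 : ∀ x → 1 + x ≡ 0 [mod 4 ] → ¬ (8 * x ≡ 0 [mod 16 ])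
1+x≡0-mod4⇒8x≢0-mod16 0 (from-% ()) _
1+x≡0-mod4⇒8x≢0-mod16 1 (from-% ()) _
1+x≡0-mod4⇒8x≢0-mod16 2 (from-% ()) _
1+x≡0-mod4⇒8x≢0-mod16 3 _ (from-% ())
1+x≡0-mod4⇒8x≢0-mod16 (suc (suc (suc (suc y)))) 5+y≡0 8[4+y]≡0 =
  1+x≡0-mod4⇒8x≢0-mod16 y (from-% (to-% 5+y≡0))  -- (5 + y) % 4 reduces to (1 + y) % 4
    (mod-trans (mod-sym (+-*-mod (8 * y) 2)) (mod-trans (mod-reflexive (identity y)) 8[4+y]≡0))
  where
  identity : ∀ y → 8 * y + 2 * 16 ≡ 8 * (4 + y)
  identity = solve-∀

npow-+ : ∀ w p q → npow w (p + q) ≡ npow w p ++ npow w q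
npow-+ w zero q = refl
npow-+ w (suc p) q = trans (cong (w ++_) (npow-+ w p q)) (sym (++-assoc w (npow w p) (npow w q)))

npow-* : ∀ w p k → npow (npow w p) k ≡ npow w (k * p)
npow-* w p zero = refl
npow-* w p (suc k) = trans (cong (npow w p ++_) (npow-* w p k)) (sym (npow-+ w p (k * p)))

invL-involutive : ∀ x → invL (invL x) ≡ x
invL-involutive (g , s) = cong (g ,_) (not-involutive s)

invW-∷ : ∀ x w → invW (x ∷ w) ≡ invW w ++ invL x ∷ []
invW-∷ x w = unfold-reverse (invL x) (map invL w)

invW-++ : ∀ u w → invW (u ++ w) ≡ invW w ++ invW u
invW-++ u w = trans (cong reverse (map-++ invL u w)) (reverse-++ (map invL u) (map invL w))

module Presented (m n : ℕ) where

  infix 4 _≈_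
  _≈_ : Word → Word → Set
  u ≈ w = u ≈⟨ m , n ⟩ w

  ≈-setoid : Setoid 0ℓ 0ℓ
  ≈-setoid = record
    { Carrier = Word
    ; _≈_ = _≈_
    ; isEquivalence = record { refl = ≈-refl ; sym = ≈-sym ; trans = ≈-trans }
    }

  module ≈-Reasoning = SetoidReasoning ≈-setoid

  ≈-reflexive : ∀ {u w} → u ≡ w → u ≈ w
  ≈-reflexive refl = ≈-refl

  ++-congˡ : ∀ p {u w} → u ≈ w → p ++ u ≈ p ++ w
  ++-congˡ p ≈-refl = ≈-refl
  ++-congˡ p (≈-sym e) = ≈-sym (++-congˡ p e)
  ++-congˡ p (≈-trans e f) = ≈-trans (++-congˡ p e) (++-congˡ p f)
  ++-congˡ p (≈-cancel u w x) =
    subst₂ _≈_ (++-assoc p u _) (++-assoc p u w) (≈-cancel (p ++ u) w x)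
  ++-congˡ p (≈-rel u w r R) =
    subst₂ _≈_ (++-assoc p u _) (++-assoc p u w) (≈-rel (p ++ u) w r R)

  ++-congʳ : ∀ q {u w} → u ≈ w → u ++ q ≈ w ++ q
  ++-congʳ q ≈-refl = ≈-refl
  ++-congʳ q (≈-sym e) = ≈-sym (++-congʳ q e)
  ++-congʳ q (≈-trans e f) = ≈-trans (++-congʳ q e) (++-congʳ q f)
  ++-congʳ q (≈-cancel u w x) =
    subst₂ _≈_ (sym (++-assoc u (x ∷ invL x ∷ w) q)) (sym (++-assoc u w q)) (≈-cancel u (w ++ q) x)
  ++-congʳ q (≈-rel u w r R) =
    subst₂ _≈_ (sym (trans (++-assoc u (r ++ w) q) (cong (u ++_) (++-assoc r w q))))
      (sym (++-assoc u w q)) (≈-rel u (w ++ q) r R)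

  ++-cong : ∀ {u u′ w w′} → u ≈ u′ → w ≈ w′ → u ++ w ≈ u′ ++ w′
  ++-cong {u′ = u′} {w} u≈u′ w≈w′ = ≈-trans (++-congʳ w u≈u′) (++-congˡ u′ w≈w′)

  invL-cancel : ∀ u w x → u ++ invL x ∷ x ∷ w ≈ u ++ w
  invL-cancel u w x =
    subst (λ y → u ++ invL x ∷ y ∷ w ≈ u ++ w) (invL-involutive x) (≈-cancel u w (invL x))

  invW-inverseˡ : ∀ x → invW x ++ x ≈ []
  invW-inverseˡ [] = ≈-refl
  invW-inverseˡ (y ∷ x) = begin
    invW (y ∷ x) ++ y ∷ x             ≡⟨ cong (_++ y ∷ x) (invW-∷ y x) ⟩
    (invW x ++ invL y ∷ []) ++ y ∷ x  ≡⟨ ++-assoc (invW x) _ _ ⟩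
    invW x ++ invL y ∷ y ∷ x          ≈⟨ invL-cancel (invW x) x y ⟩
    invW x ++ x                       ≈⟨ invW-inverseˡ x ⟩
    []                                ∎
    where open ≈-Reasoning

  invW-inverseʳ : ∀ x → x ++ invW x ≈ []
  invW-inverseʳ [] = ≈-refl
  invW-inverseʳ (y ∷ x) = begin
    y ∷ x ++ invW (y ∷ x)                  ≡⟨ cong (λ z → y ∷ x ++ z) (invW-∷ y x) ⟩
    y ∷ x ++ invW x ++ invL y ∷ []         ≡⟨ cong (y ∷_) (++-assoc x (invW x) _) ⟨
    y ∷ (x ++ invW x) ++ invL y ∷ []       ≈⟨ ++-congˡ (y ∷ []) (++-congʳ (invL y ∷ []) (invW-inverseʳ x)) ⟩
    y ∷ invL y ∷ []                        ≈⟨ ≈-cancel [] [] y ⟩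
    []                                     ∎
    where open ≈-Reasoning

  ≈[]⇒≈invW : ∀ {x y} → x ++ y ≈ [] → x ≈ invW y
  ≈[]⇒≈invW {x} {y} xy≈[] = begin
    x                    ≡⟨ ++-identityʳ x ⟨
    x ++ []              ≈⟨ ++-congˡ x (invW-inverseʳ y) ⟨
    x ++ y ++ invW y     ≡⟨ ++-assoc x y (invW y) ⟨
    (x ++ y) ++ invW y   ≈⟨ ++-congʳ (invW y) xy≈[] ⟩
    invW y               ∎
    where open ≈-Reasoning

  idempotent⇒≈[] : ∀ {x} → x ++ x ≈ x → x ≈ []
  idempotent⇒≈[] {x} xx≈x = begin
    x                    ≈⟨ ++-congʳ x (invW-inverseˡ x) ⟨
    (invW x ++ x) ++ x   ≡⟨ ++-assoc (invW x) x x ⟩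
    invW x ++ x ++ x     ≈⟨ ++-congˡ (invW x) xx≈x ⟩
    invW x ++ x          ≈⟨ invW-inverseˡ x ⟩
    []                   ∎
    where open ≈-Reasoning

  invW-cong : ∀ {u w} → u ≈ w → invW u ≈ invW w
  invW-cong {u} u≈w = ≈[]⇒≈invW (≈-trans (++-congˡ (invW u) (≈-sym u≈w)) (invW-inverseˡ u))

  npow-cong : ∀ {u w} k → u ≈ w → npow u k ≈ npow w k
  npow-cong zero u≈w = ≈-refl
  npow-cong (suc k) u≈w = ++-cong u≈w (npow-cong k u≈w)

  comm-cong : ∀ {x x′ y y′} → x ≈ x′ → y ≈ y′ → comm x y ≈ comm x′ y′
  comm-cong x≈x′ y≈y′ = ++-cong (invW-cong x≈x′) (++-cong (invW-cong y≈y′) (++-cong x≈x′ y≈y′))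

  relator-elim : ∀ u {r} → Relator m n r → u ++ r ≈ u
  relator-elim u {r} R = subst₂ _≈_ (cong (u ++_) (++-identityʳ r)) (++-identityʳ u) (≈-rel u [] r R)

  npow-period : ∀ w d → npow w d ≈ [] → ∀ q → npow w (q * d) ≈ []
  npow-period w d wᵈ≈[] zero = ≈-refl
  npow-period w d wᵈ≈[] (suc q) =
    ≈-trans (≈-reflexive (npow-+ w d (q * d))) (++-cong wᵈ≈[] (npow-period w d wᵈ≈[] q))

  npow-mod : ∀ w d .{{_ : NonZero d}} → npow w d ≈ [] → ∀ j → npow w j ≈ npow w (j % d)
  npow-mod w d wᵈ≈[] j = begin
    npow w j                              ≡⟨ cong (npow w) (m≡m%n+[m/n]*n j d) ⟩
    npow w (j % d + j / d * d)            ≡⟨ npow-+ w (j % d) (j / d * d) ⟩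
    npow w (j % d) ++ npow w (j / d * d)  ≈⟨ ++-congˡ (npow w (j % d)) (npow-period w d wᵈ≈[] (j / d)) ⟩
    npow w (j % d) ++ []                  ≡⟨ ++-identityʳ (npow w (j % d)) ⟩
    npow w (j % d)                        ∎
    where open ≈-Reasoning

  module AutProperties (φ : Aut m n) where
    open Aut φ

    f-[] : f [] ≈ []
    f-[] = idempotent⇒≈[] (≈-sym (hom [] []))

    f-npow : ∀ z k → f (npow z k) ≈ npow (f z) k
    f-npow z zero = f-[]
    f-npow z (suc k) = ≈-trans (hom z (npow z k)) (++-congˡ (f z) (f-npow z k))

    f-invW : ∀ z → f (invW z) ≈ invW (f z)
    f-invW z = ≈[]⇒≈invW (≈-trans (≈-sym (hom (invW z) z)) (≈-trans (resp (invW-inverseˡ z)) f-[]))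

    f-comm : ∀ x y → f (comm x y) ≈ comm (f x) (f y)
    f-comm x y =
      ≈-trans (hom _ _) (++-cong (f-invW x) (≈-trans (hom _ _) (++-cong (f-invW y) (hom x y))))

  module AbelianInvariant (d : ℕ) .{{_ : NonZero d}} (h : Word → ℕ)
      (h-++ : ∀ u w → h (u ++ w) ≡ h u + h w [mod d ])
      (h-cong : ∀ {u w} → u ≈ w → h u ≡ h w [mod d ]) where

    open SetoidReasoning (mod-setoid {d})

    h-[] : h [] ≡ 0 [mod d ]
    h-[] = mod-sym (+-cancelˡ-mod (h []) (begin
      h [] + 0      ≡⟨ +-identityʳ (h []) ⟩
      h []          ≈⟨ h-++ [] [] ⟩
      h [] + h []   ∎))

    h-invW-++ : ∀ u w → h u ≡ h w [mod d ] → h (invW u ++ w) ≡ 0 [mod d ]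
    h-invW-++ u w hu≡hw = begin
      h (invW u ++ w)     ≈⟨ h-++ (invW u) w ⟩
      h (invW u) + h w    ≈⟨ +-cong-mod (mod-refl {x = h (invW u)}) hu≡hw ⟨
      h (invW u) + h u    ≈⟨ h-++ (invW u) u ⟨
      h (invW u ++ u)     ≈⟨ h-cong (invW-inverseˡ u) ⟩
      h []                ≈⟨ h-[] ⟩
      0                   ∎

    h-invW : ∀ z → h z ≡ 0 [mod d ] → h (invW z) ≡ 0 [mod d ]
    h-invW z hz≡0 = begin
      h (invW z)          ≡⟨ cong h (++-identityʳ (invW z)) ⟨
      h (invW z ++ [])    ≈⟨ h-invW-++ z [] (mod-trans hz≡0 (mod-sym h-[])) ⟩
      0                   ∎

    h-++-comm : ∀ x y → h (x ++ y) ≡ h (y ++ x) [mod d ]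
    h-++-comm x y = begin
      h (x ++ y)    ≈⟨ h-++ x y ⟩
      h x + h y     ≡⟨ +-comm (h x) (h y) ⟩
      h y + h x     ≈⟨ h-++ y x ⟨
      h (y ++ x)    ∎

    h-comm : ∀ x y → h (comm x y) ≡ 0 [mod d ]
    h-comm x y = begin
      h (comm x y)                  ≡⟨ cong h (++-assoc (invW x) (invW y) (x ++ y)) ⟨
      h ((invW x ++ invW y) ++ x ++ y) ≡⟨ cong (λ z → h (z ++ x ++ y)) (invW-++ y x) ⟨
      h (invW (y ++ x) ++ x ++ y)   ≈⟨ h-invW-++ (y ++ x) (x ++ y) (h-++-comm y x) ⟩
      0                             ∎

    h-npow : ∀ z → h z ≡ 0 [mod d ] → ∀ k → h (npow z k) ≡ 0 [mod d ]
    h-npow z hz≡0 zero = h-[]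
    h-npow z hz≡0 (suc k) = mod-trans (h-++ z (npow z k)) (+-cong-mod hz≡0 (h-npow z hz≡0 k))

module Semidirect (v n′ : ℕ) where

  m n t : ℕ
  m = 4 + 4 * v
  n = suc n′
  t = 1 + 4 * v

  open Presented m n

  a⁻≈a^[m∸1] : a⁻ ≈ npow a (3 + 4 * v)
  a⁻≈a^[m∸1] = ≈-trans (≈-sym (relator-elim a⁻ rel-a)) (≈-cancel [] _ (ga , false))

  b⁻≈b^n′ : b⁻ ≈ npow b n′
  b⁻≈b^n′ = ≈-trans (≈-sym (relator-elim b⁻ rel-b)) (≈-cancel [] _ (gb , false))

  a⁻³≈a^t : npow a⁻ 3 ≈ npow a t
  a⁻³≈a^t = begin
    npow a⁻ 3                          ≈⟨ relator-elim (npow a⁻ 3) rel-a ⟨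
    npow a⁻ 3 ++ npow a m              ≈⟨ ≈-cancel (npow a⁻ 2) _ (ga , false) ⟩
    npow a⁻ 2 ++ npow a 2 ++ npow a t  ≈⟨ ≈-cancel a⁻ _ (ga , false) ⟩
    a⁻ ++ a ++ npow a t                ≈⟨ ≈-cancel [] _ (ga , false) ⟩
    npow a t                           ∎
    where open ≈-Reasoning

  ab≈ba^t : a ++ b ≈ b ++ npow a t
  ab≈ba^t = begin
    a ++ b                             ≈⟨ relator-elim (a ++ b) rel-ba ⟨
    a ++ b ++ comm b a ++ npow a⁻ 4    ≈⟨ ≈-cancel a _ (gb , true) ⟩
    a ++ a⁻ ++ b ++ a ++ npow a⁻ 4     ≈⟨ ≈-cancel [] _ (ga , true) ⟩
    b ++ a ++ npow a⁻ 4                ≈⟨ ≈-cancel b _ (ga , true) ⟩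
    b ++ npow a⁻ 3                     ≈⟨ ++-congˡ b a⁻³≈a^t ⟩
    b ++ npow a t                      ∎
    where open ≈-Reasoning

  a⁴≈[b,a] : npow a 4 ≈ comm b a
  a⁴≈[b,a] = ≈-sym (≈[]⇒≈invW (relator-elim [] rel-ba))

  a^k-b≈b-a^kt : ∀ k → npow a k ++ b ≈ b ++ npow a (k * t)
  a^k-b≈b-a^kt zero = ≈-refl
  a^k-b≈b-a^kt (suc k) = begin
    a ++ npow a k ++ b                ≈⟨ ++-congˡ a (a^k-b≈b-a^kt k) ⟩
    a ++ b ++ npow a (k * t)          ≈⟨ ++-congʳ (npow a (k * t)) ab≈ba^t ⟩
    b ++ npow a t ++ npow a (k * t)   ≡⟨ cong (b ++_) (npow-+ a t (k * t)) ⟨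
    b ++ npow a (suc k * t)           ∎
    where open ≈-Reasoning

  a^k-b^j≈b^j-a^kt^j : ∀ k j → npow a k ++ npow b j ≈ npow b j ++ npow a (k * t ^ j)
  a^k-b^j≈b^j-a^kt^j k zero =
    ≈-reflexive (trans (++-identityʳ (npow a k)) (cong (npow a) (sym (*-identityʳ k))))
  a^k-b^j≈b^j-a^kt^j k (suc j) = begin
    npow a k ++ b ++ npow b j                 ≡⟨ ++-assoc (npow a k) b (npow b j) ⟨
    (npow a k ++ b) ++ npow b j               ≈⟨ ++-congʳ (npow b j) (a^k-b≈b-a^kt k) ⟩
    b ++ npow a (k * t) ++ npow b j           ≈⟨ ++-congˡ b (a^k-b^j≈b^j-a^kt^j (k * t) j) ⟩
    b ++ npow b j ++ npow a (k * t * t ^ j)   ≡⟨ cong (λ e → b ++ npow b j ++ npow a e) (*-assoc k t (t ^ j)) ⟩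
    b ++ npow b j ++ npow a (k * t ^ suc j)   ∎
    where open ≈-Reasoning

  -- (j , i) stands for b ^ j a ^ i, and b⁻¹ a b = a ^ t gives the product.
  Pair : Set
  Pair = ℕ × ℕ

  infixl 7 _·_
  _·_ : Pair → Pair → Pair
  (j , i) · (l , k) = j + l , i * t ^ l + k

  ·-assoc : ∀ p q r → (p · q) · r ≡ p · (q · r)
  ·-assoc (j , i) (l , k) (p , q) = cong₂ _,_ (+-assoc j l p) (begin
    (i * t ^ l + k) * t ^ p + q        ≡⟨ expand i k q (t ^ l) (t ^ p) ⟩
    i * (t ^ l * t ^ p) + (k * t ^ p + q) ≡⟨ cong (λ e → i * e + (k * t ^ p + q)) (^-distribˡ-+-* t l p) ⟨
    i * t ^ (l + p) + (k * t ^ p + q)  ∎)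
    where
    open ≡-Reasoning
    expand : ∀ i k q X Y → (i * X + k) * Y + q ≡ i * (X * Y) + (k * Y + q)
    expand = solve-∀

  letter : Letter → Pair
  letter (ga , true) = 0 , 1
  letter (ga , false) = 0 , 3 + 4 * v
  letter (gb , true) = 1 , 0
  letter (gb , false) = n′ , 0

  eval : Word → Pair
  eval [] = 0 , 0
  eval (x ∷ w) = letter x · eval w

  eval-++ : ∀ u w → eval (u ++ w) ≡ eval u · eval w
  eval-++ [] w = refl
  eval-++ (x ∷ u) w =
    trans (cong (letter x ·_) (eval-++ u w)) (sym (·-assoc (letter x) (eval u) (eval w)))

  eval-npow-a : ∀ k → eval (npow a k) ≡ (0 , k)
  eval-npow-a zero = refl
  eval-npow-a (suc k) = cong (letter (ga , true) ·_) (eval-npow-a k)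

  eval-npow-b : ∀ k → eval (npow b k) ≡ (k , 0)
  eval-npow-b zero = refl
  eval-npow-b (suc k) = cong (letter (gb , true) ·_) (eval-npow-b k)

  eval-[b,a]a⁻⁴ : proj₂ (eval (comm b a ++ npow a⁻ 4)) ≡ m * m
  eval-[b,a]a⁻⁴ = identity t
    where
    -- the unfolded left-hand side, with a⁻¹ ↦ 2 + t = m ∸ 1
    identity : ∀ t → (2 + t) * (t * 1)
                       + (0 * 1 + (1 * 1 + ((2 + t) * 1 + ((2 + t) * 1 + ((2 + t) * 1 + ((2 + t) * 1 + 0))))))
                     ≡ (3 + t) * (3 + t)
    identity = solve-∀

  infix 4 _~_
  record _~_ (p q : Pair) : Set where
    constructor _,~_
    field
      ~₁ : proj₁ p ≡ proj₁ q [mod n ]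
      ~₂ : proj₂ p ≡ proj₂ q [mod m ]
  open _~_

  ~-refl : ∀ {p} → p ~ p
  ~-refl = mod-refl ,~ mod-refl

  ~-reflexive : ∀ {p q} → p ≡ q → p ~ q
  ~-reflexive refl = ~-refl

  ~-setoid : Setoid 0ℓ 0ℓ
  ~-setoid = record
    { Carrier = Pair
    ; _≈_ = _~_
    ; isEquivalence = record
      { refl = ~-refl
      ; sym = λ (e ,~ f) → mod-sym e ,~ mod-sym f
      ; trans = λ (e ,~ f) (e′ ,~ f′) → mod-trans e e′ ,~ mod-trans f f′
      }
    }

  module ~-Reasoning = SetoidReasoning ~-setoid
  open Setoid ~-setoid using () renaming (sym to ~-sym; trans to ~-trans)

  module Model (t^n≡1 : t ^ n ≡ 1 [mod m ]) where

    ·-cong : ∀ {p p′ q q′} → p ~ p′ → q ~ q′ → p · q ~ p′ · q′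
    ·-cong (j≡j′ ,~ i≡i′) (l≡l′ ,~ k≡k′) =
      +-cong-mod j≡j′ l≡l′ ,~ +-cong-mod (*-cong-mod i≡i′ (^-congʳ-mod t^n≡1 l≡l′)) k≡k′

    letter-invL : ∀ x p → letter x · (letter (invL x) · p) ~ p
    letter-invL x p = ~-trans (~-reflexive (sym (·-assoc (letter x) (letter (invL x)) p)))
                              (·-cong (inverse x) (~-refl {p}))
      where
      a⁻a≡m : (3 + 4 * v) * 1 + 1 ≡ m
      a⁻a≡m = trans (+-comm _ 1) (cong suc (*-identityʳ (3 + 4 * v)))
      inverse : ∀ x → letter x · letter (invL x) ~ (0 , 0)
      inverse (ga , true) = mod-refl ,~ d≡0-mod
      inverse (ga , false) = mod-refl ,~ mod-trans (mod-reflexive a⁻a≡m) d≡0-mod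
      inverse (gb , true) = d≡0-mod ,~ mod-refl
      inverse (gb , false) = mod-trans (mod-reflexive (+-comm n′ 1)) d≡0-mod ,~ mod-refl

    relator-trivial : ∀ {r} → Relator m n r → eval r ~ (0 , 0)
    relator-trivial rel-a = ~-trans (~-reflexive (eval-npow-a m)) (mod-refl ,~ d≡0-mod)
    relator-trivial rel-b = ~-trans (~-reflexive (eval-npow-b n)) (d≡0-mod ,~ mod-refl)
    relator-trivial rel-ba = mod-trans (mod-reflexive (+-comm n′ 1)) d≡0-mod
                          ,~ mod-trans (mod-reflexive eval-[b,a]a⁻⁴) (+-*-mod 0 m)

    eval-sound : ∀ {u w} → u ≈ w → eval u ~ eval w
    eval-sound ≈-refl = ~-refl
    eval-sound (≈-sym e) = ~-sym (eval-sound e)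
    eval-sound (≈-trans e f) = ~-trans (eval-sound e) (eval-sound f)
    eval-sound (≈-cancel u w x) = begin
      eval (u ++ x ∷ invL x ∷ w)                   ≡⟨ eval-++ u _ ⟩
      eval u · (letter x · (letter (invL x) · eval w)) ≈⟨ ·-cong (~-refl {eval u}) (letter-invL x (eval w)) ⟩
      eval u · eval w                              ≡⟨ eval-++ u w ⟨
      eval (u ++ w)                                ∎
      where open ~-Reasoning
    eval-sound (≈-rel u w r R) = begin
      eval (u ++ r ++ w)           ≡⟨ trans (eval-++ u (r ++ w)) (cong (eval u ·_) (eval-++ r w)) ⟩
      eval u · (eval r · eval w)   ≈⟨ ·-cong (~-refl {eval u}) (·-cong (relator-trivial R) (~-refl {eval w})) ⟩
      eval u · ((0 , 0) · eval w)  ≡⟨⟩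
      eval u · eval w              ≡⟨ eval-++ u w ⟨
      eval (u ++ w)                ∎
      where open ~-Reasoning

    nf : Pair → Word
    nf (j , i) = npow b j ++ npow a i

    a^k-nf : ∀ k j i → npow a k ++ nf (j , i) ≈ nf (j , k * t ^ j + i)
    a^k-nf k j i = begin
      npow a k ++ npow b j ++ npow a i              ≡⟨ ++-assoc (npow a k) (npow b j) (npow a i) ⟨
      (npow a k ++ npow b j) ++ npow a i            ≈⟨ ++-congʳ (npow a i) (a^k-b^j≈b^j-a^kt^j k j) ⟩
      (npow b j ++ npow a (k * t ^ j)) ++ npow a i  ≡⟨ ++-assoc (npow b j) (npow a (k * t ^ j)) (npow a i) ⟩
      npow b j ++ npow a (k * t ^ j) ++ npow a i    ≡⟨ cong (npow b j ++_) (npow-+ a (k * t ^ j) i) ⟨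
      nf (j , k * t ^ j + i)                        ∎
      where open ≈-Reasoning

    letter-nf : ∀ x p → x ∷ nf p ≈ nf (letter x · p)
    letter-nf (ga , true) (j , i) = a^k-nf 1 j i
    letter-nf (ga , false) (j , i) = ≈-trans (++-congʳ (nf (j , i)) a⁻≈a^[m∸1]) (a^k-nf (3 + 4 * v) j i)
    letter-nf (gb , true) (j , i) = ≈-refl
    letter-nf (gb , false) (j , i) = begin
      b⁻ ++ npow b j ++ npow a i         ≈⟨ ++-congʳ (nf (j , i)) b⁻≈b^n′ ⟩
      npow b n′ ++ npow b j ++ npow a i  ≡⟨ ++-assoc (npow b n′) (npow b j) (npow a i) ⟨
      (npow b n′ ++ npow b j) ++ npow a i ≡⟨ cong (_++ npow a i) (npow-+ b n′ j) ⟨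
      nf (n′ + j , i)                    ∎
      where open ≈-Reasoning

    nf-eval : ∀ w → w ≈ nf (eval w)
    nf-eval [] = ≈-refl
    nf-eval (x ∷ w) = ≈-trans (++-congˡ (x ∷ []) (nf-eval w)) (letter-nf x (eval w))

    nf-reduce : ∀ j i → nf (j , i) ≈ nf (j % n , i % m)
    nf-reduce j i =
      ++-cong (npow-mod b n (relator-elim [] rel-b) j) (npow-mod a m (relator-elim [] rel-a) i)

    nf-cong : ∀ {p q} → p ~ q → nf p ≈ nf q
    nf-cong {j , i} {l , k} (from-% j≡l ,~ from-% i≡k) = begin
      nf (j , i)           ≈⟨ nf-reduce j i ⟩
      nf (j % n , i % m)   ≡⟨ cong₂ (λ x y → nf (x , y)) j≡l i≡k ⟩
      nf (l % n , k % m)   ≈⟨ nf-reduce l k ⟨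
      nf (l , k)           ∎
      where open ≈-Reasoning

    eval-complete : ∀ {u w} → eval u ~ eval w → u ≈ w
    eval-complete {u} {w} eu~ew = ≈-trans (nf-eval u) (≈-trans (nf-cong eu~ew) (≈-sym (nf-eval w)))

    b-exponent a-exponent : Word → ℕ
    b-exponent w = proj₁ (eval w)
    a-exponent w = proj₂ (eval w)

    t≡1-mod4 : t ≡ 1 [mod 4 ]
    t≡1-mod4 = mod-trans (mod-reflexive (cong suc (*-comm 4 v))) (+-*-mod 1 v)

    4∣m : 4 ∣ m
    4∣m = divides (1 + v) (cong (λ e → 4 + e) (*-comm 4 v))

    b-exponent-++ : ∀ u w → b-exponent (u ++ w) ≡ b-exponent u + b-exponent w [mod n ]
    b-exponent-++ u w = mod-reflexive (cong proj₁ (eval-++ u w))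

    a-exponent-++ : ∀ u w → a-exponent (u ++ w) ≡ a-exponent u + a-exponent w [mod 4 ]
    a-exponent-++ u w = mod-trans (mod-reflexive (cong proj₂ (eval-++ u w)))
      (+-cong-mod (*-≡1-mod (a-exponent u) (^-≡1-mod t≡1-mod4 (b-exponent w))) mod-refl)

    b-exponent-cong : ∀ {u w} → u ≈ w → b-exponent u ≡ b-exponent w [mod n ]
    b-exponent-cong u≈w = ~₁ (eval-sound u≈w)

    a-exponent-cong : ∀ {u w} → u ≈ w → a-exponent u ≡ a-exponent w [mod 4 ]
    a-exponent-cong u≈w = mod-∣ 4∣m (~₂ (eval-sound u≈w))

    module B = AbelianInvariant n b-exponent b-exponent-++ b-exponent-cong
    module A = AbelianInvariant 4 a-exponent a-exponent-++ a-exponent-cong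

    record Ker (w : Word) : Set where
      constructor _,_
      field
        b-exponent≡0 : b-exponent w ≡ 0 [mod n ]
        a-exponent≡0 : a-exponent w ≡ 0 [mod 4 ]

    Ker-cong : ∀ {u w} → u ≈ w → Ker u → Ker w
    Ker-cong u≈w (bu≡0 , au≡0) =
      mod-trans (mod-sym (b-exponent-cong u≈w)) bu≡0 , mod-trans (mod-sym (a-exponent-cong u≈w)) au≡0

    Ker-comm : ∀ x y → Ker (comm x y)
    Ker-comm x y = B.h-comm x y , A.h-comm x y

    Ker-npow : ∀ {z} → Ker z → ∀ k → Ker (npow z k)
    Ker-npow {z} (bz≡0 , az≡0) k = B.h-npow z bz≡0 k , A.h-npow z az≡0 k

    Ker-invW : ∀ {z} → Ker z → Ker (invW z)
    Ker-invW {z} (bz≡0 , az≡0) = B.h-invW z bz≡0 , A.h-invW z az≡0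

    Ker-a⁴ : Ker (npow a 4)
    Ker-a⁴ = Ker-cong (≈-sym a⁴≈[b,a]) (Ker-comm b a)

    InN⇒Ker : ∀ {w} → InN m n w → Ker w
    InN⇒Ker (+ k , w≈a⁴ᵏ) = Ker-cong (≈-sym w≈a⁴ᵏ) (Ker-npow Ker-a⁴ k)
    InN⇒Ker (-[1+ k ] , w≈a⁻⁴ᵏ) = Ker-cong (≈-sym w≈a⁻⁴ᵏ) (Ker-npow (Ker-invW Ker-a⁴) (suc k))

    Ker⇒≈a⁴ᵏ : ∀ {w} → Ker w → w ≈ npow (npow a 4) (a-exponent w / 4)
    Ker⇒≈a⁴ᵏ {w} (bw≡0 , from-% aw%4≡0) = eval-complete (begin
      eval w                   ≈⟨ bw≡0 ,~ mod-reflexive (sym (m/n*n≡m (m%n≡0⇒n∣m (a-exponent w) 4 aw%4≡0))) ⟩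
      (0 , k * 4)              ≡⟨ eval-npow-a (k * 4) ⟨
      eval (npow a (k * 4))    ≡⟨ cong eval (npow-* a 4 k) ⟨
      eval (npow (npow a 4) k) ∎)
      where
      open ~-Reasoning
      k = a-exponent w / 4

    Ker⇒InN : ∀ {w} → Ker w → InN m n w
    Ker⇒InN {w} kw = + (a-exponent w / 4) , Ker⇒≈a⁴ᵏ kw

    module _ (φ : Aut m n) where
      open Aut φ
      open AutProperties φ

      Ker-image : ∀ {w} → Ker w → Ker (f w)
      Ker-image {w} kw = Ker-cong (≈-sym fw≈) (Ker-npow Ker-f-a⁴ k)
        where
        k = a-exponent w / 4
        Ker-f-a⁴ : Ker (f (npow a 4))
        Ker-f-a⁴ = Ker-cong (≈-sym (≈-trans (resp a⁴≈[b,a]) (f-comm b a))) (Ker-comm (f b) (f a))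
        fw≈ : f w ≈ npow (f (npow a 4)) k
        fw≈ = ≈-trans (resp (Ker⇒≈a⁴ᵏ kw)) (f-npow (npow a 4) k)

      Ker-preimage : ∀ {w} → Ker (f w) → Ker w
      Ker-preimage {w} kfw = Ker-cong (≈-sym w≈) (Ker-npow (Ker-comm x y) k)
        where
        x = proj₁ (surj b)
        y = proj₁ (surj a)
        k = a-exponent (f w) / 4
        f[x,y]≈a⁴ : f (comm x y) ≈ npow a 4
        f[x,y]≈a⁴ = ≈-trans (f-comm x y)
                      (≈-trans (comm-cong (proj₂ (surj b)) (proj₂ (surj a))) (≈-sym a⁴≈[b,a]))
        w≈ : w ≈ npow (comm x y) k
        w≈ = inj (≈-trans (Ker⇒≈a⁴ᵏ kfw)
                   (≈-sym (≈-trans (f-npow (comm x y) k) (npow-cong k f[x,y]≈a⁴))))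

    characteristic : Characteristic m n
    characteristic φ w = (λ w∈N → Ker⇒InN (Ker-image φ (InN⇒Ker w∈N)))
                       , (λ fw∈N → Ker⇒InN (Ker-preimage φ (InN⇒Ker fw∈N)))

    quotientAbelian : QuotientAbelian m n
    quotientAbelian x y = Ker⇒InN (B.h-invW-++ (y ++ x) (x ++ y) (B.h-++-comm y x)
                                  , A.h-invW-++ (y ++ x) (x ++ y) (A.h-++-comm y x))

    eval-npow : ∀ {z c} → eval z ~ (0 , c) → ∀ k → eval (npow z k) ~ (0 , k * c)
    eval-npow ez~c zero = ~-refl
    eval-npow {z} {c} ez~c (suc k) = begin
      eval (z ++ npow z k)          ≡⟨ eval-++ z (npow z k) ⟩
      eval z · eval (npow z k)      ≈⟨ ·-cong ez~c (eval-npow ez~c k) ⟩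
      (0 , c * 1 + k * c)           ≡⟨ cong (λ e → 0 , e + k * c) (*-identityʳ c) ⟩
      (0 , suc k * c)               ∎
      where open ~-Reasoning

    -- t ≡ -3 (mod m), since t + 3 = m
    t²≡9 : ∀ i → t * (t * i) ≡ 9 * i [mod m ]
    t²≡9 i = begin
      t * (t * i)                  ≈⟨ +-*-mod (t * (t * i)) (6 * i) ⟨
      t * (t * i) + 6 * i * m      ≡⟨ identity v i ⟩
      9 * i + m * i * m            ≈⟨ +-*-mod (9 * i) (m * i) ⟩
      9 * i                        ∎
      where
      open SetoidReasoning (mod-setoid {m})
      identity : ∀ v i → (1 + 4 * v) * ((1 + 4 * v) * i) + 6 * i * (4 + 4 * v)
                       ≡ 9 * i + (4 + 4 * v) * i * (4 + 4 * v)
      identity = solve-∀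

    it^n′≡ti⇒8i≡0 : ∀ i → i * t ^ n′ ≡ t * i [mod m ] → 8 * i ≡ 0 [mod m ]
    it^n′≡ti⇒8i≡0 i it^n′≡ti = mod-sym (+-cancelˡ-mod i (begin
      i + 0                ≡⟨ +-identityʳ i ⟩
      i                    ≈⟨ *-≡1-mod i t^n≡1 ⟨
      i * (t * t ^ n′)     ≡⟨ x∙yz≈y∙xz i t (t ^ n′) ⟩
      t * (i * t ^ n′)     ≈⟨ *-cong-mod (mod-refl {x = t}) it^n′≡ti ⟩
      t * (t * i)          ≈⟨ t²≡9 i ⟩
      9 * i                ∎))
      where open SetoidReasoning (mod-setoid {m})

    eval-relation : ∀ {A B i j} → eval A ~ (0 , i) → eval B ~ (n′ , j) →
                    A ++ B ≈ B ++ npow A t → (0 , i) · (n′ , j) ~ (n′ , j) · (0 , t * i)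
    eval-relation {A} {B} {i} {j} eA eB AB≈BAᵗ = begin
      (0 , i) · (n′ , j)         ≈⟨ ·-cong eA eB ⟨
      eval A · eval B            ≡⟨ eval-++ A B ⟨
      eval (A ++ B)              ≈⟨ eval-sound AB≈BAᵗ ⟩
      eval (B ++ npow A t)       ≡⟨ eval-++ B (npow A t) ⟩
      eval B · eval (npow A t)   ≈⟨ ·-cong eB (eval-npow eA t) ⟩
      (n′ , j) · (0 , t * i)     ∎
      where open ~-Reasoning

    relation⇒it^n′≡ti : ∀ {i j} → (0 , i) · (n′ , j) ~ (n′ , j) · (0 , t * i) →
                        i * t ^ n′ ≡ t * i [mod m ]
    relation⇒it^n′≡ti {i} {j} relation = +-cancelˡ-mod j (begin
      j + i * t ^ n′             ≡⟨ +-comm j (i * t ^ n′) ⟩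
      i * t ^ n′ + j             ≈⟨ ~₂ relation ⟩
      j * 1 + t * i              ≡⟨ cong (_+ t * i) (*-identityʳ j) ⟩
      j + t * i                  ∎)
      where open SetoidReasoning (mod-setoid {m})

    noInducedInversion : 16 ∣ m → ¬ Σ (Aut m n) (InducesInversion m n)
    noInducedInversion 16∣m (φ , inverts) =
      1+x≡0-mod4⇒8x≢0-mod16 i 1+i≡0
        (mod-∣ 16∣m (it^n′≡ti⇒8i≡0 i (relation⇒it^n′≡ti (eval-relation eA eB AB≈BAᵗ))))
      where
      open Aut φ
      A = f a
      B = f b
      i = a-exponent A
      aA∈Ker = InN⇒Ker (inverts a)
      bB∈Ker = InN⇒Ker (inverts b)
      1+i≡0 : 1 + i ≡ 0 [mod 4 ]
      1+i≡0 = mod-trans (mod-sym (a-exponent-++ a A)) (Ker.a-exponent≡0 aA∈Ker)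
      eA : eval A ~ (0 , i)
      eA = Ker.b-exponent≡0 aA∈Ker ,~ mod-refl
      eB : eval B ~ (n′ , a-exponent B)
      eB = +-cancelˡ-mod 1 (mod-trans (Ker.b-exponent≡0 bB∈Ker) (mod-sym d≡0-mod)) ,~ mod-refl
      AB≈BAᵗ : A ++ B ≈ B ++ npow A t
      AB≈BAᵗ = ≈-trans (≈-sym (hom a b)) (≈-trans (resp ab≈ba^t)
                 (≈-trans (hom b (npow a t)) (++-congˡ B (AutProperties.f-npow φ a t))))

[1+4w]^2^s≡1+2^[2+s]q : ∀ w s → ∃ λ q → (1 + 4 * w) ^ (2 ^ s) ≡ 1 + 2 ^ (2 + s) * q
[1+4w]^2^s≡1+2^[2+s]q w zero = w , *-identityʳ (1 + 4 * w)
[1+4w]^2^s≡1+2^[2+s]q w (suc s) with [1+4w]^2^s≡1+2^[2+s]q w s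
... | q , eq = q + 2 ^ suc s * (q * q) , (begin
  (1 + 4 * w) ^ (2 * 2 ^ s)                    ≡⟨ cong ((1 + 4 * w) ^_) (*-comm 2 (2 ^ s)) ⟩
  (1 + 4 * w) ^ (2 ^ s * 2)                    ≡⟨ ^-*-assoc (1 + 4 * w) (2 ^ s) 2 ⟨
  ((1 + 4 * w) ^ (2 ^ s)) ^ 2                  ≡⟨ cong (_^ 2) eq ⟩
  (1 + 2 ^ (2 + s) * q) ^ 2                    ≡⟨ square (2 ^ suc s) q ⟩
  1 + 2 ^ (3 + s) * (q + 2 ^ suc s * (q * q))  ∎)
  where
  open ≡-Reasoning
  square : ∀ P q → (1 + 2 * P * q) * ((1 + 2 * P * q) * 1) ≡ 1 + 2 * (2 * P) * (q + P * (q * q))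
  square = solve-∀

[1+4w]^2^l≡1 : ∀ w l {d} .{{_ : NonZero d}} → d ∣ 2 ^ (2 + l) → (1 + 4 * w) ^ (2 ^ l) ≡ 1 [mod d ]
[1+4w]^2^l≡1 w l d∣2^[2+l] with [1+4w]^2^s≡1+2^[2+s]q w l
... | q , eq = mod-trans (mod-reflexive eq) (from-% (%-remove-+ʳ 1 (∣m⇒∣m*n q d∣2^[2+l])))

IsPow2-≤⇒∣ : ∀ {x y} → IsPow2 x → IsPow2 y → x ≤ y → x ∣ y
IsPow2-≤⇒∣ (k , refl) (j , refl) 2^k≤2^j = divides (2 ^ (j ∸ k)) (begin
  2 ^ j                  ≡⟨ cong (2 ^_) (m+[n∸m]≡n k≤j) ⟨
  2 ^ (k + (j ∸ k))      ≡⟨ ^-distribˡ-+-* 2 k (j ∸ k) ⟩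
  2 ^ k * 2 ^ (j ∸ k)    ≡⟨ *-comm (2 ^ k) (2 ^ (j ∸ k)) ⟩
  2 ^ (j ∸ k) * 2 ^ k    ∎)
  where
  open ≡-Reasoning
  k≤j : k ≤ j
  k≤j = ≮⇒≥ (λ j<k → <⇒≱ (^-monoʳ-< 2 (s≤s (s≤s z≤n)) j<k) 2^k≤2^j)

4∣⇒≡4+4v : ∀ {x} → 4 ∣ x → 0 < x → ∃ λ v → x ≡ 4 + 4 * v
4∣⇒≡4+4v (divides (suc v) refl) _ = v , cong (λ e → 4 + e) (*-comm v 4)

data Admissible : ℕ → ℕ → Set where
  admissible : ∀ v n′ → (1 + 4 * v) ^ suc n′ ≡ 1 [mod 4 + 4 * v ] → 16 ∣ 4 + 4 * v →
               Admissible (4 + 4 * v) (suc n′)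

IsPow2⇒Admissible : ∀ {m n} → IsPow2 m → IsPow2 n → 16 ≤ m → 4 ≤ n → m ≤ 4 * n → Admissible m n
IsPow2⇒Admissible {n = suc n′} pm (l , n≡2^l) 16≤m (s≤s _) m≤4n
  with IsPow2-≤⇒∣ (4 , refl) pm 16≤m
... | 16∣m with 4∣⇒≡4+4v (∣-trans (divides 4 refl) 16∣m) (≤-trans (s≤s z≤n) 16≤m)
... | v , refl = admissible v n′ t^n≡1 16∣m
  where
  4n≡2^[2+l] : 4 * suc n′ ≡ 2 ^ (2 + l)
  4n≡2^[2+l] = trans (cong (4 *_) n≡2^l) (*-assoc 2 2 (2 ^ l))
  m∣2^[2+l] : 4 + 4 * v ∣ 2 ^ (2 + l)
  m∣2^[2+l] = IsPow2-≤⇒∣ pm (2 + l , refl) (subst (4 + 4 * v ≤_) 4n≡2^[2+l] m≤4n)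
  t^n≡1 : (1 + 4 * v) ^ suc n′ ≡ 1 [mod 4 + 4 * v ]
  t^n≡1 = subst (λ e → (1 + 4 * v) ^ e ≡ 1 [mod 4 + 4 * v ]) (sym n≡2^l) ([1+4w]^2^l≡1 v l m∣2^[2+l])

lemma3 : (m n : ℕ) → IsPow2 m → IsPow2 n → 16 ≤ m → 4 ≤ n → m ≤ 4 * n →
    Characteristic m n × QuotientAbelian m n ×
      ¬ (Σ (Aut m n) (λ φ → InducesInversion m n φ))
lemma3 m n pm pn 16≤m 4≤n m≤4n with IsPow2⇒Admissible pm pn 16≤m 4≤n m≤4n
... | admissible v n′ t^n≡1 16∣m = characteristic , quotientAbelian , noInducedInversion 16∣m
  where open Semidirect.Model v n′ t^n≡1
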